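{- For every $n\ge 1$, every 2D word of size $(2,n)$ (over any finite alphabet) has at most $2n$ distinct non-empty HV-palindromic factors, and there exists a 2D word of size $(2,n)$ with exactly $2n$ distinct non-empty HV-palindromic factors. That is, the maximum number of HV-palindromes in a 2D word of size $(2,n)$ is $2n$.
   Context: A 2D word of size $(m,n)$ over a finite alphabet $\Sigma$ is an $m\times n$ array $w=[w_{i,j}]$ with entries in $\Sigma$; its rows and columns are 1D words. A factor of $w$ is a sub-array $[w_{i,j}]_{a\le i\le b,\,c\le j\le d}$ with $1\le a\le b\le m$, $1\le c\le d\le n$; factors are counted as distinct arrays, independently of their positions. A 1D word is a palindrome if it equals its reversal, and a 2D word is an HV-palindrome if each of its rows and each of its columns is a 1D palindrome. -}

module Defs where

open import Data.Nat using (ℕ; suc; _≤_)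
open import Data.Fin using (Fin; toℕ)
open import Data.Fin.Properties using (_≟_)
import Data.Fin.Properties as FinP
open import Data.List using (List; []; _∷_; map; reverse; filter; length; deduplicate; concatMap; allFin)
open import Data.List.Properties using (≡-dec)
open import Data.List.Relation.Unary.All using (All; all?)
open import Data.Product using (_×_; _,_; Σ; proj₁; proj₂)
open import Relation.Binary.PropositionalEquality using (_≡_)
open import Relation.Nullary using (Dec)
open import Relation.Nullary.Decidable using (_×-dec_)

Word2D : Set → ℕ → ℕ → Set
Word2D A m n = Fin m → Fin n → A

Palindrome : {A : Set} → List A → Set
Palindrome l = reverse l ≡ l

range : {m : ℕ} → Fin m → Fin m → List (Fin m)
range {m} a b = filter (λ i → (toℕ a Data.Nat.≤? toℕ i) ×-dec (toℕ i Data.Nat.≤? toℕ b)) (allFin m)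

record Pos (m n : ℕ) : Set where
  constructor pos
  field
    a b : Fin m
    c d : Fin n
    a≤b : toℕ a ≤ toℕ b
    c≤d : toℕ c ≤ toℕ d
open Pos public

-- The factor at a position, as its list of rows (a non-empty rectangular array;
-- distinct arrays correspond exactly to distinct lists of rows).
factorRows : {A : Set} {m n : ℕ} → Word2D A m n → Pos m n → List (List A)
factorRows w p = map (λ i → map (w i) (range (c p) (d p))) (range (a p) (b p))

factorCols : {A : Set} {m n : ℕ} → Word2D A m n → Pos m n → List (List A)
factorCols w p = map (λ j → map (λ i → w i j) (range (a p) (b p))) (range (c p) (d p))

IsHVPalFactor : {A : Set} {m n : ℕ} → Word2D A m n → Pos m n → Set
IsHVPalFactor w p = All Palindrome (factorRows w p) × All Palindrome (factorCols w p)

allPos : (m n : ℕ) → List (Pos m n)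
allPos m n =
  concatMap (λ a → concatMap (λ b → concatMap (λ c → concatMap (λ d → helper a b c d)
    (allFin n)) (allFin n)) (allFin m)) (allFin m)
  where
  helper : Fin m → Fin m → Fin n → Fin n → List (Pos m n)
  helper a b c d with toℕ a Data.Nat.≤? toℕ b | toℕ c Data.Nat.≤? toℕ d
  ... | Relation.Nullary.yes p | Relation.Nullary.yes q = pos a b c d p q ∷ []
  ... | _ | _ = []

module _ {k : ℕ} where
  private
    A = Fin k
    pal? : (l : List A) → Dec (Palindrome l)
    pal? l = ≡-dec _≟_ (reverse l) l

  isHVPal? : {m n : ℕ} (w : Word2D A m n) (p : Pos m n) → Dec (IsHVPalFactor w p)
  isHVPal? w p = all? pal? (factorRows w p) ×-dec all? pal? (factorCols w p)

  numHVPal : {m n : ℕ} → Word2D A m n → ℕ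
  numHVPal {m} {n} w =
    length (deduplicate (≡-dec (≡-dec _≟_))
      (map (factorRows w) (filter (isHVPal? w) (allPos m n))))

-- A non-empty palindrome u occurring in a word x is the longest palindromic
-- suffix of the prefix of x that ends at the first occurrence of u: a longer
-- palindromic suffix L there would have u as a suffix, hence by symmetry also
-- as a prefix, so u would occur earlier. So the palindromic factors of a row of
-- length n are among the n longest palindromic suffixes of its prefixes.
-- The columns of an HV-palindrome of height 2 are palindromes of length 2, so
-- its two rows agree, and that row is a palindromic factor of both rows of the
-- word. Taking, for the i-th prefix of the first row, its longest palindromic
-- suffix u as the factor [ u ], and for the i-th prefix of the second row, its
-- longest palindromic suffix v as [ v ] if v is not among the former and as
-- [ v ; v ] otherwise, gives 2n arrays covering every HV-palindromic factor.
-- Two constant rows over distinct letters attain the bound.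
module Submission where

open import Defs
open import Data.Bool using (if_then_else_)
open import Data.Fin using (Fin; toℕ; zero; suc)
open import Data.Fin.Properties using (toℕ-injective; toℕ<n)
import Data.Fin.Properties as Fin
open import Data.List
  using (List; []; _∷_; [_]; _++_; _∷ʳ_; length; map; reverse; replicate; take; drop; filter;
         allFin; upTo; concatMap; deduplicate; cartesianProductWith)
open import Data.List.Properties
  using (++-identityʳ; ++-assoc; length-++; length-++-≤ˡ; length-++-≤ʳ; length-map; length-take;
         length-tabulate; length-upTo; length-replicate; reverse-++; unfold-reverse; map-++;
         map-tabulate; map-cong-local; take-map; drop-map; take-take; take-drop; take++drop≡id;
         filter-++; filter-all; filter-none; ∷-injectiveˡ; ∷-injectiveʳ; ≡-dec)
open import Data.List.Membership.Propositional using (_∈_)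
open import Data.List.Membership.Propositional.Properties
  using (∈-map⁺; ∈-map⁻; ∈-++⁺ˡ; ∈-++⁺ʳ; ∈-++⁻; ∈-∃++; ∈-allFin; ∈-upTo⁺; ∈-filter⁺; ∈-filter⁻;
         ∈-concatMap⁺; ∈-deduplicate⁺; ∈-deduplicate⁻; ∈-cartesianProductWith⁻)
import Data.List.Membership.DecPropositional as DecMembership
open import Data.List.Relation.Binary.Subset.Propositional using (_⊆_)
open import Data.List.Relation.Unary.All using (All; []; _∷_)
import Data.List.Relation.Unary.All as All
import Data.List.Relation.Unary.All.Properties as All
import Data.List.Relation.Unary.Any as Any
open import Data.List.Relation.Unary.AllPairs using (_∷_)
open import Data.List.Relation.Unary.Unique.Propositional using (Unique)
open import Data.List.Relation.Unary.Unique.Propositional.Properties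
  using (allFin⁺; cartesianProductWith⁺)
open import Data.List.Relation.Unary.Unique.DecPropositional.Properties using (deduplicate-!)
open import Data.Nat using (ℕ; zero; suc; _+_; _*_; _∸_; _⊓_; _≤_; _<_; _≤?_; z≤n; s≤s; s≤s⁻¹)
open import Data.Nat.Induction using (<-wellFounded)
open import Data.Nat.Properties
  using (≤-refl; ≤-trans; ≤-reflexive; <⇒≤; <⇒≱; <⇒≢; <-≤-trans; ≤-antisym; m⊓n≤m; m≤n⇒m⊓n≡m;
         m+[n∸m]≡n; m≤n⇒m<n∨m≡n; +-monoʳ-<; +-identityʳ; +-suc; suc-injective; n≤1+n;
         module ≤-Reasoning)
open import Data.Product using (_×_; Σ; ∃-syntax; _,_; proj₁; proj₂)
open import Data.Sum using (inj₁; inj₂)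
open import Function using (_∘_)
open import Induction.WellFounded using (Acc; acc)
open import Relation.Binary.Definitions using (DecidableEquality)
open import Relation.Binary.PropositionalEquality hiding ([_])
open import Relation.Nullary using (Dec; yes; no; does; contradiction)
open import Relation.Nullary.Decidable using (dec-true; dec-false; _×-dec_)

module _ {A : Set} where

  Prefix Suffix : List A → List A → Set
  Prefix u x = ∃[ s ] u ++ s ≡ x
  Suffix u x = ∃[ p ] p ++ u ≡ x

  prefix-refl : ∀ x → Prefix x x
  prefix-refl x = [] , ++-identityʳ x

  prefix-trans : ∀ {u v x} → Prefix u v → Prefix v x → Prefix u x
  prefix-trans {u} (s , refl) (s′ , refl) = s ++ s′ , sym (++-assoc u s s′)

  take-prefix : ∀ i x → Prefix (take i x) x
  take-prefix i x = drop i x , take++drop≡id i x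

  prefix-length : ∀ {u x} → Prefix u x → length u ≤ length x
  prefix-length {u} (_ , refl) = length-++-≤ˡ u

  prefix-take : ∀ {u x} → Prefix u x → take (length u) x ≡ u
  prefix-take {[]}    _        = refl
  prefix-take {a ∷ u} (s , refl) = cong (a ∷_) (prefix-take (s , refl))

  non-empty-prefix-is-take : ∀ {a t x} → Prefix (a ∷ t) x →
                             ∃[ i ] i < length x × a ∷ t ≡ take (suc i) x
  non-empty-prefix-is-take pre = _ , prefix-length pre , sym (prefix-take pre)

  suffix-length : ∀ {u x} → Suffix u x → length u ≤ length x
  suffix-length {u} (p , refl) = length-++-≤ʳ u {p}

  common-suffix : ∀ p q {u v} → p ++ u ≡ q ++ v → length u ≤ length v → Suffix u v
  common-suffix p       []      eq _   = p , eq
  common-suffix []      (b ∷ q) {v = v} refl u≤v = contradiction u≤v (<⇒≱ (s≤s (length-++-≤ʳ v {q})))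
  common-suffix (a ∷ p) (b ∷ q) eq u≤v = common-suffix p q (∷-injectiveʳ eq) u≤v

  suffix-of-equal-length : ∀ {u v} → Suffix u v → length u ≡ length v → u ≡ v
  suffix-of-equal-length     ([]    , refl) _     = refl
  suffix-of-equal-length {u} (a ∷ p , refl) |u|≡ = contradiction |u|≡ (<⇒≢ (s≤s (length-++-≤ʳ u {p})))

  palindromic-suffix-is-prefix : ∀ (t : List A) {u} → Palindrome (t ++ u) → Palindrome u →
                                 t ++ u ≡ u ++ reverse t
  palindromic-suffix-is-prefix t {u} pal-tu pal-u = begin
    t ++ u                 ≡⟨ sym pal-tu ⟩
    reverse (t ++ u)       ≡⟨ reverse-++ t u ⟩
    reverse u ++ reverse t ≡⟨ cong (_++ reverse t) pal-u ⟩
    u ++ reverse t         ∎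
    where open ≡-Reasoning

  replicate-palindrome : ∀ ℓ (x : A) → Palindrome (replicate ℓ x)
  replicate-palindrome zero    x = refl
  replicate-palindrome (suc ℓ) x = begin
    reverse (x ∷ replicate ℓ x)  ≡⟨ unfold-reverse x (replicate ℓ x) ⟩
    reverse (replicate ℓ x) ∷ʳ x ≡⟨ cong (_∷ʳ x) (replicate-palindrome ℓ x) ⟩
    replicate ℓ x ∷ʳ x           ≡⟨ replicate-∷ʳ ℓ ⟩
    x ∷ replicate ℓ x            ∎
    where
    open ≡-Reasoning
    replicate-∷ʳ : ∀ ℓ → replicate ℓ x ∷ʳ x ≡ x ∷ replicate ℓ x
    replicate-∷ʳ zero    = refl
    replicate-∷ʳ (suc ℓ) = cong (x ∷_) (replicate-∷ʳ ℓ)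

  map-const : ∀ {B : Set} (y : B) (xs : List A) → map (λ _ → y) xs ≡ replicate (length xs) y
  map-const y []       = refl
  map-const y (x ∷ xs) = cong (y ∷_) (map-const y xs)

  Unique-⊆⇒length≤ : ∀ {xs ys : List A} → Unique xs → xs ⊆ ys → length xs ≤ length ys
  Unique-⊆⇒length≤ {[]}     _                _    = z≤n
  Unique-⊆⇒length≤ {x ∷ xs} (x∉xs ∷ unique) xs⊆ys with ∈-∃++ (xs⊆ys (Any.here refl))
  ... | ys , zs , refl = begin
    suc (length xs)             ≤⟨ s≤s (Unique-⊆⇒length≤ unique xs⊆ys∖x) ⟩
    suc (length (ys ++ zs))     ≡⟨ cong suc (length-++ ys) ⟩
    suc (length ys + length zs) ≡⟨ sym (+-suc (length ys) (length zs)) ⟩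
    length ys + length (x ∷ zs) ≡⟨ sym (length-++ ys) ⟩
    length (ys ++ x ∷ zs)       ∎
    where
    open ≤-Reasoning
    xs⊆ys∖x : xs ⊆ ys ++ zs
    xs⊆ys∖x {z} z∈xs with ∈-++⁻ ys (xs⊆ys (Any.there z∈xs))
    ... | inj₁ z∈ys             = ∈-++⁺ˡ z∈ys
    ... | inj₂ (Any.here refl)  = contradiction refl (All.lookup x∉xs z∈xs)
    ... | inj₂ (Any.there z∈zs) = ∈-++⁺ʳ ys z∈zs

map-suffix : ∀ {A B : Set} (f : A → B) {u x} → Suffix u x → Suffix (map f u) (map f x)
map-suffix f {u} (p , refl) = map f p , sym (map-++ f p u)

module LongestPalindromicSuffix {A : Set} (_≟_ : DecidableEquality A) where

  palindrome? : (u : List A) → Dec (Palindrome u)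
  palindrome? u = ≡-dec _≟_ (reverse u) u

  lps : List A → List A
  lps []       = []
  lps (x ∷ xs) with palindrome? (x ∷ xs)
  ... | yes _ = x ∷ xs
  ... | no  _ = lps xs

  lps-suffix : ∀ xs → Suffix (lps xs) xs
  lps-suffix []       = [] , refl
  lps-suffix (x ∷ xs) with palindrome? (x ∷ xs)
  ... | yes _ = [] , refl
  ... | no  _ with lps-suffix xs
  ...   | p , eq = x ∷ p , cong (x ∷_) eq

  lps-palindrome : ∀ xs → Palindrome (lps xs)
  lps-palindrome []       = refl
  lps-palindrome (x ∷ xs) with palindrome? (x ∷ xs)
  ... | yes pal = pal
  ... | no  _   = lps-palindrome xs

  lps-longest : ∀ xs {u} → Palindrome u → Suffix u xs → length u ≤ length (lps xs)
  lps-longest []       _   su = suffix-length su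
  lps-longest (x ∷ xs) pal su with palindrome? (x ∷ xs)
  lps-longest (x ∷ xs) pal su            | yes _   = suffix-length su
  lps-longest (x ∷ xs) pal ([] , refl)   | no ¬pal = contradiction pal ¬pal
  lps-longest (x ∷ xs) pal (_ ∷ p , eq)  | no _    = lps-longest xs pal (p , ∷-injectiveʳ eq)

  palindromic-suffix-is-lps-of-prefix : ∀ y {u} → Palindrome u → Suffix u y →
                                        ∃[ y′ ] Prefix y′ y × u ≡ lps y′
  palindromic-suffix-is-lps-of-prefix y = go y (<-wellFounded (length y))
    where
    go : ∀ y {u} → Acc _<_ (length y) → Palindrome u → Suffix u y → ∃[ y′ ] Prefix y′ y × u ≡ lps y′
    go y {u} (acc rec) pal-u (p , pu≡y) with lps-suffix y | m≤n⇒m<n∨m≡n (lps-longest y pal-u (p , pu≡y))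
    ... | q , qL≡y | inj₂ |u|≡|L| =
      y , prefix-refl y , suffix-of-equal-length (common-suffix p q pu≡qL (≤-reflexive |u|≡|L|)) |u|≡|L|
      where pu≡qL = trans pu≡y (sym qL≡y)
    ... | q , qL≡y | inj₁ |u|<|L| with common-suffix p q (trans pu≡y (sym qL≡y)) (<⇒≤ |u|<|L|)
    ...   | t , tu≡L =
      let y′ , pre , u≡ = go (q ++ u) (rec shorter) pal-u (q , refl)
      in  y′ , prefix-trans pre (reverse t , earlier) , u≡
      where
      shorter : length (q ++ u) < length y
      shorter = begin-strict
        length (q ++ u)           ≡⟨ length-++ q ⟩
        length q + length u       <⟨ +-monoʳ-< (length q) |u|<|L| ⟩
        length q + length (lps y) ≡⟨ sym (length-++ q) ⟩
        length (q ++ lps y)       ≡⟨ cong length qL≡y ⟩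
        length y                  ∎
        where open ≤-Reasoning
      earlier : (q ++ u) ++ reverse t ≡ y
      earlier = begin
        (q ++ u) ++ reverse t ≡⟨ ++-assoc q u (reverse t) ⟩
        q ++ (u ++ reverse t) ≡⟨ cong (q ++_) (sym (palindromic-suffix-is-prefix t
                                   (subst Palindrome (sym tu≡L) (lps-palindrome y)) pal-u)) ⟩
        q ++ (t ++ u)         ≡⟨ cong (q ++_) tu≡L ⟩
        q ++ lps y            ≡⟨ qL≡y ⟩
        y                     ∎
        where open ≡-Reasoning

allFin-suc : ∀ n → allFin (suc n) ≡ zero ∷ map suc (allFin n)
allFin-suc n = cong (zero ∷_) (sym (map-tabulate (λ i → i) suc))

allFin-take-< : ∀ n k → All (λ i → toℕ i < k) (take k (allFin n))
allFin-take-< zero    zero    = []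
allFin-take-< zero    (suc k) = []
allFin-take-< (suc n) zero    = []
allFin-take-< (suc n) (suc k) =
  subst (All (λ i → toℕ i < suc k) ∘ take (suc k)) (sym (allFin-suc n))
        (s≤s z≤n ∷ subst (All (λ i → toℕ i < suc k)) (sym (take-map k (allFin n)))
                         (All.map⁺ (All.map s≤s (allFin-take-< n k))))

allFin-drop-≥ : ∀ n k → All (λ i → k ≤ toℕ i) (drop k (allFin n))
allFin-drop-≥ n       zero    = All.universal (λ _ → z≤n) (allFin n)
allFin-drop-≥ zero    (suc k) = []
allFin-drop-≥ (suc n) (suc k) =
  subst (All (λ i → suc k ≤ toℕ i) ∘ drop (suc k)) (sym (allFin-suc n))
        (subst (All (λ i → suc k ≤ toℕ i)) (sym (drop-map k (allFin n)))
               (All.map⁺ (All.map s≤s (allFin-drop-≥ n k))))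

range≡drop-take : ∀ {n} (c d : Fin n) → toℕ c ≤ toℕ d →
                  range c d ≡ drop (toℕ c) (take (suc (toℕ d)) (allFin n))
range≡drop-take {n} c d c≤d = begin
  filter P? (allFin n)                             ≡⟨ cong (filter P?) (sym split) ⟩
  filter P? (take c′ T ++ drop c′ T ++ D)          ≡⟨ filter-++ P? (take c′ T) _ ⟩
  filter P? (take c′ T) ++ filter P? (drop c′ T ++ D)
                                                   ≡⟨ cong₂ _++_ before (filter-++ P? (drop c′ T) D) ⟩
  filter P? (drop c′ T) ++ filter P? D             ≡⟨ cong₂ _++_ inside after ⟩
  drop c′ T ++ []                                  ≡⟨ ++-identityʳ _ ⟩
  drop c′ T                                        ∎
  where
  open ≡-Reasoning
  c′ d′ : ℕ
  c′ = toℕ c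
  d′ = toℕ d
  T D : List (Fin n)
  T = take (suc d′) (allFin n)
  D = drop (suc d′) (allFin n)
  P? = λ (i : Fin n) → (c′ ≤? toℕ i) ×-dec (toℕ i ≤? d′)
  split : take c′ T ++ drop c′ T ++ D ≡ allFin n
  split = begin
    take c′ T ++ drop c′ T ++ D   ≡⟨ sym (++-assoc (take c′ T) (drop c′ T) D) ⟩
    (take c′ T ++ drop c′ T) ++ D ≡⟨ cong (_++ D) (take++drop≡id c′ T) ⟩
    T ++ D                        ≡⟨ take++drop≡id (suc d′) (allFin n) ⟩
    allFin n                      ∎
  before : filter P? (take c′ T) ≡ []
  before = filter-none P? (All.map (λ i<c (c≤i , _) → <⇒≱ (<-≤-trans i<c (m⊓n≤m c′ (suc d′))) c≤i)
                                   (subst (All _) (sym (take-take c′ (suc d′) (allFin n)))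
                                          (allFin-take-< n (c′ ⊓ suc d′))))
  inside : filter P? (drop c′ T) ≡ drop c′ T
  inside = filter-all P? (All.zip (c≤ , ≤d))
    where
    c≤ : All (λ i → c′ ≤ toℕ i) (drop c′ T)
    c≤ = subst (All _) (trans (take-drop (suc d′ ∸ c′) c′ (allFin n))
                              (cong (λ k → drop c′ (take k (allFin n)))
                                    (m+[n∸m]≡n (≤-trans c≤d (n≤1+n d′)))))
               (All.take⁺ (suc d′ ∸ c′) (allFin-drop-≥ n c′))
    ≤d : All (λ i → toℕ i ≤ d′) (drop c′ T)
    ≤d = All.drop⁺ c′ (All.map s≤s⁻¹ (allFin-take-< n (suc d′)))
  after : filter P? D ≡ []
  after = filter-none P? (All.map (λ d<i (_ , i≤d) → <⇒≱ d<i i≤d) (allFin-drop-≥ n (suc d′)))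

range-suffix : ∀ {n} (c d : Fin n) → toℕ c ≤ toℕ d → Suffix (range c d) (take (suc (toℕ d)) (allFin n))
range-suffix c d c≤d =
  take (toℕ c) T , trans (cong (take (toℕ c) T ++_) (range≡drop-take c d c≤d)) (take++drop≡id (toℕ c) T)
  where T = take (suc (toℕ d)) (allFin _)

∈-range : ∀ {n} (c d : Fin n) → toℕ c ≤ toℕ d → c ∈ range c d
∈-range c d c≤d = ∈-filter⁺ (λ i → (toℕ c ≤? toℕ i) ×-dec (toℕ i ≤? toℕ d))
                            (∈-allFin c) (≤-refl , c≤d)

length-range-zero : ∀ {n} (d : Fin (suc n)) → length (range zero d) ≡ suc (toℕ d)
length-range-zero {n} d = begin
  length (range zero d)                         ≡⟨ cong length (range≡drop-take zero d z≤n) ⟩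
  length (take (suc (toℕ d)) (allFin (suc n)))  ≡⟨ length-take (suc (toℕ d)) (allFin (suc n)) ⟩
  suc (toℕ d) ⊓ length (allFin (suc n))         ≡⟨ cong (suc (toℕ d) ⊓_) (length-tabulate (λ i → i)) ⟩
  suc (toℕ d) ⊓ suc n                           ≡⟨ m≤n⇒m⊓n≡m (toℕ<n d) ⟩
  suc (toℕ d)                                   ∎
  where open ≡-Reasoning

module _ {k m n : ℕ} (w : Word2D (Fin k) m n) where

  hvPalFactors : List (List (List (Fin k)))
  hvPalFactors = map (factorRows w) (filter (isHVPal? w) (allPos m n))

  ∈-hvPalFactors : ∀ {p} → p ∈ allPos m n → IsHVPalFactor w p → factorRows w p ∈ hvPalFactors
  ∈-hvPalFactors p∈ hv = ∈-map⁺ (factorRows w) (∈-filter⁺ (isHVPal? w) p∈ hv)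

  numHVPal≤ : ∀ {S} → (∀ p → IsHVPalFactor w p → factorRows w p ∈ S) → numHVPal w ≤ length S
  numHVPal≤ covered = Unique-⊆⇒length≤ (deduplicate-! _ hvPalFactors) dedup⊆S
    where
    dedup⊆S : deduplicate _ hvPalFactors ⊆ _
    dedup⊆S f∈ with ∈-map⁻ (factorRows w) (∈-deduplicate⁻ _ hvPalFactors f∈)
    ... | p , p∈ , refl = covered p (proj₂ (∈-filter⁻ (isHVPal? w) {xs = allPos m n} p∈))

  numHVPal≥ : ∀ {T} → Unique T → T ⊆ hvPalFactors → length T ≤ numHVPal w
  numHVPal≥ unique T⊆ = Unique-⊆⇒length≤ unique (∈-deduplicate⁺ _ ∘ T⊆)

palindromic-columns⇒equal-rows : ∀ {X Y : Set} {f g : X → Y} xs →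
                                 All Palindrome (map (λ j → f j ∷ g j ∷ []) xs) → map f xs ≡ map g xs
palindromic-columns⇒equal-rows xs columns =
  map-cong-local (All.map (λ pal → sym (∷-injectiveˡ pal)) (All.map⁻ columns))

∈⇒map≢[] : ∀ {X Y : Set} {f : X → Y} {x : X} {xs} → x ∈ xs → map f xs ≢ []
∈⇒map≢[] {xs = _ ∷ _} _ ()

module TwoRowWord {k n : ℕ} (w : Word2D (Fin k) 2 n) where

  open LongestPalindromicSuffix (Fin._≟_ {k})
  open DecMembership (≡-dec (≡-dec (Fin._≟_ {k}))) using (_∈?_)

  row : Fin 2 → List (Fin k)
  row r = map (w r) (allFin n)

  prefixLps : Fin 2 → ℕ → List (Fin k)
  prefixLps r i = lps (take (suc i) (row r))

  palindromic-row-factor : ∀ {r c d} → toℕ c ≤ toℕ d → Palindrome (map (w r) (range c d)) →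
                           ∃[ i ] i < n × map (w r) (range c d) ≡ prefixLps r i
  palindromic-row-factor {r} {c} {d} c≤d pal
    with palindromic-suffix-is-lps-of-prefix (take (suc (toℕ d)) (row r)) pal
           (subst (Suffix _) (sym (take-map (suc (toℕ d)) (allFin n)))
                  (map-suffix (w r) (range-suffix c d c≤d)))
  ... | []    , _   , u≡[] = contradiction u≡[] (∈⇒map≢[] (∈-range c d c≤d))
  ... | a ∷ t , pre , u≡lps
    with non-empty-prefix-is-take (prefix-trans pre (take-prefix (suc (toℕ d)) (row r)))
  ...   | i , i<|row| , eq = i , subst (i <_) |row|≡n i<|row| , trans u≡lps (cong lps eq)
    where
    |row|≡n : length (row r) ≡ n
    |row|≡n = trans (length-map (w r) (allFin n)) (length-tabulate (λ i → i))

  firstRowSlots : List (List (List (Fin k)))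
  firstRowSlots = map (λ i → [ prefixLps zero i ]) (upTo n)

  secondRowSlot : ℕ → List (List (Fin k))
  secondRowSlot i = let v = prefixLps (suc zero) i in
    if does ([ v ] ∈? firstRowSlots) then v ∷ [ v ] else [ v ]

  candidates : List (List (List (Fin k)))
  candidates = firstRowSlots ++ map secondRowSlot (upTo n)

  length-candidates : length candidates ≡ 2 * n
  length-candidates = begin
    length candidates                                          ≡⟨ length-++ firstRowSlots ⟩
    length firstRowSlots + length (map secondRowSlot (upTo n))
                                                               ≡⟨ cong₂ _+_ (|map-upTo| _) (|map-upTo| _) ⟩
    n + n                                                      ≡⟨ cong (n +_) (sym (+-identityʳ n)) ⟩
    2 * n                                                      ∎
    where
    open ≡-Reasoning
    |map-upTo| : ∀ {X : Set} (f : ℕ → X) → length (map f (upTo n)) ≡ n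
    |map-upTo| f = trans (length-map f (upTo n)) (length-upTo n)

  first-row-candidate : ∀ {i} → i < n → [ prefixLps zero i ] ∈ candidates
  first-row-candidate i<n = ∈-++⁺ˡ (∈-map⁺ _ (∈-upTo⁺ i<n))

  secondRowSlot∈candidates : ∀ {i} → i < n → secondRowSlot i ∈ candidates
  secondRowSlot∈candidates i<n = ∈-++⁺ʳ firstRowSlots (∈-map⁺ secondRowSlot (∈-upTo⁺ i<n))

  second-row-candidate : ∀ {i} → i < n → [ prefixLps (suc zero) i ] ∈ candidates
  second-row-candidate {i} i<n with [ prefixLps (suc zero) i ] ∈? firstRowSlots
  ... | yes old = ∈-++⁺ˡ old
  ... | no  new = subst (_∈ candidates) slot≡ (secondRowSlot∈candidates i<n)
    where
    v = prefixLps (suc zero) i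
    slot≡ : secondRowSlot i ≡ [ v ]
    slot≡ = cong (λ b → if b then v ∷ [ v ] else [ v ]) (dec-false ([ v ] ∈? firstRowSlots) new)

  square-candidate : ∀ {i} → i < n → [ prefixLps (suc zero) i ] ∈ firstRowSlots →
                     prefixLps (suc zero) i ∷ [ prefixLps (suc zero) i ] ∈ candidates
  square-candidate {i} i<n old = subst (_∈ candidates) slot≡ (secondRowSlot∈candidates i<n)
    where
    v = prefixLps (suc zero) i
    slot≡ : secondRowSlot i ≡ v ∷ [ v ]
    slot≡ = cong (λ b → if b then v ∷ [ v ] else [ v ]) (dec-true ([ v ] ∈? firstRowSlots) old)

  hvPal∈candidates : ∀ p → IsHVPalFactor w p → factorRows w p ∈ candidates
  hvPal∈candidates (pos zero zero c d _ c≤d) (pal ∷ [] , _) with palindromic-row-factor c≤d pal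
  ... | i , i<n , u≡ = subst (λ u → [ u ] ∈ candidates) (sym u≡) (first-row-candidate i<n)
  hvPal∈candidates (pos (suc zero) (suc zero) c d _ c≤d) (pal ∷ [] , _)
    with palindromic-row-factor c≤d pal
  ... | i , i<n , u≡ = subst (λ u → [ u ] ∈ candidates) (sym u≡) (second-row-candidate i<n)
  hvPal∈candidates (pos zero (suc zero) c d _ c≤d) (pal₀ ∷ pal₁ ∷ [] , columns)
    with palindromic-row-factor c≤d pal₀ | palindromic-row-factor c≤d pal₁
  ... | i₀ , i₀<n , u₀≡ | i₁ , i₁<n , u₁≡ =
    subst (_∈ candidates) (cong₂ (λ a b → a ∷ [ b ]) (sym (trans u₀≡u₁ u₁≡)) (sym u₁≡))
          (square-candidate i₁<n (subst (λ u → [ u ] ∈ firstRowSlots) (trans (sym u₀≡) (trans u₀≡u₁ u₁≡))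
                                        (∈-map⁺ _ (∈-upTo⁺ i₀<n))))
    where
    u₀≡u₁ : map (w zero) (range c d) ≡ map (w (suc zero)) (range c d)
    u₀≡u₁ = palindromic-columns⇒equal-rows (range c d) columns
  hvPal∈candidates (pos (suc zero) zero _ _ () _) _

numHVPal-2×n : ∀ {k n} (w : Word2D (Fin k) 2 n) → numHVPal w ≤ 2 * n
numHVPal-2×n w = subst (numHVPal w ≤_) length-candidates (numHVPal≤ w hvPal∈candidates)
  where open TwoRowWord w

length-cartesianProductWith : ∀ {A B C : Set} (f : A → B → C) xs ys →
                              length (cartesianProductWith f xs ys) ≡ length xs * length ys
length-cartesianProductWith f []       ys = refl
length-cartesianProductWith f (x ∷ xs) ys =
  trans (length-++ (map (f x) ys))
        (cong₂ _+_ (length-map (f x) ys) (length-cartesianProductWith f xs ys))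

PosEnumerator : ℕ → ℕ → Set
PosEnumerator m n = Fin m → Fin m → Fin n → Fin n → List (Pos m n)

enumerate : ∀ {m n} → PosEnumerator m n → List (Pos m n)
enumerate {m} {n} h =
  concatMap (λ a → concatMap (λ b → concatMap (λ c → concatMap (λ d → h a b c d)
    (allFin n)) (allFin n)) (allFin m)) (allFin m)

-- allPos is enumerate applied to its local helper, which cannot be named directly
allPos-enumerated : ∀ m n → Σ (PosEnumerator m n) λ h → allPos m n ≡ enumerate h
allPos-enumerated m n = _ , refl

∈-enumerate : ∀ {m n} (h : PosEnumerator m n) p → p ∈ h (a p) (b p) (c p) (d p) → p ∈ enumerate h
∈-enumerate h p p∈h =
  ∈-concat (a p) (∈-allFin _) (∈-concat (b p) (∈-allFin _)
    (∈-concat (c p) (∈-allFin _) (∈-concat (d p) (∈-allFin _) p∈h)))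
  where
  ∈-concat : ∀ {X Y : Set} {f : X → List Y} {xs y} x → x ∈ xs → y ∈ f x → y ∈ concatMap f xs
  ∈-concat {f = f} x x∈xs y∈fx = ∈-concatMap⁺ f (Any.map (λ { refl → y∈fx }) x∈xs)

module ConstantRows {n : ℕ} where

  constantRows : Word2D (Fin 2) 2 (suc n)
  constantRows r _ = r

  unaryFactor : Fin 2 → Fin (suc n) → List (List (Fin 2))
  unaryFactor r j = [ replicate (suc (toℕ j)) r ]

  unaryFactor-injective : ∀ {r s i j} → unaryFactor r i ≡ unaryFactor s j → r ≡ s × i ≡ j
  unaryFactor-injective {i = i} {j} eq =
    ∷-injectiveˡ rows≡ , toℕ-injective (suc-injective (begin
      suc (toℕ i)                            ≡⟨ sym (length-replicate (suc (toℕ i))) ⟩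
      length (replicate (suc (toℕ i)) _)     ≡⟨ cong length rows≡ ⟩
      length (replicate (suc (toℕ j)) _)     ≡⟨ length-replicate (suc (toℕ j)) ⟩
      suc (toℕ j)                            ∎))
    where
    open ≡-Reasoning
    rows≡ = ∷-injectiveˡ eq

  unaryFactors : List (List (List (Fin 2)))
  unaryFactors = cartesianProductWith unaryFactor (allFin 2) (allFin (suc n))

  rowPrefix : Fin 2 → Fin (suc n) → Pos 2 (suc n)
  rowPrefix r j = pos r r zero j ≤-refl z≤n

  rowPrefix∈allPos : ∀ r j → rowPrefix r j ∈ allPos 2 (suc n)
  rowPrefix∈allPos r j = subst (rowPrefix r j ∈_) (sym (proj₂ enumerated))
                               (∈-enumerate (proj₁ enumerated) (rowPrefix r j) (listed r))
    where
    enumerated = allPos-enumerated 2 (suc n)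
    listed : ∀ r → rowPrefix r j ∈ proj₁ enumerated r r zero j
    listed zero       = Any.here refl
    listed (suc zero) = Any.here refl

  constant-row : ∀ (r : Fin 2) (j : Fin (suc n)) →
                 map (λ _ → r) (range zero j) ≡ replicate (suc (toℕ j)) r
  constant-row r j =
    trans (map-const r (range zero j)) (cong (λ ℓ → replicate ℓ r) (length-range-zero j))

  factorRows-rowPrefix : ∀ r j → factorRows constantRows (rowPrefix r j) ≡ unaryFactor r j
  factorRows-rowPrefix zero       j = cong [_] (constant-row zero j)
  factorRows-rowPrefix (suc zero) j = cong [_] (constant-row (suc zero) j)

  constant-row-palindrome : ∀ (r : Fin 2) (j : Fin (suc n)) → Palindrome (map (λ _ → r) (range zero j))
  constant-row-palindrome r j = subst Palindrome (sym (constant-row r j)) (replicate-palindrome _ r)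

  constant-columns-palindromes : ∀ (r : Fin 2) (j : Fin (suc n)) →
                                 All Palindrome (map (λ _ → [ r ]) (range zero j))
  constant-columns-palindromes r j = All.map⁺ (All.universal (λ _ → refl) (range zero j))

  rowPrefix-hvPal : ∀ r j → IsHVPalFactor constantRows (rowPrefix r j)
  rowPrefix-hvPal zero       j =
    constant-row-palindrome zero j ∷ [] , constant-columns-palindromes zero j
  rowPrefix-hvPal (suc zero) j =
    constant-row-palindrome (suc zero) j ∷ [] , constant-columns-palindromes (suc zero) j

  numHVPal-constantRows : numHVPal constantRows ≡ 2 * suc n
  numHVPal-constantRows = ≤-antisym (numHVPal-2×n constantRows) (begin
    2 * suc n                ≡⟨ sym |unaryFactors| ⟩
    length unaryFactors      ≤⟨ numHVPal≥ constantRows unique unaryFactors⊆ ⟩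
    numHVPal constantRows    ∎)
    where
    open ≤-Reasoning
    |unaryFactors| : length unaryFactors ≡ 2 * suc n
    |unaryFactors| = trans (length-cartesianProductWith unaryFactor (allFin 2) (allFin (suc n)))
                           (cong (2 *_) (length-tabulate {n = suc n} (λ i → i)))
    unique : Unique unaryFactors
    unique = cartesianProductWith⁺ unaryFactor unaryFactor-injective (allFin⁺ 2) (allFin⁺ (suc n))
    unaryFactors⊆ : unaryFactors ⊆ hvPalFactors constantRows
    unaryFactors⊆ f∈ with ∈-cartesianProductWith⁻ unaryFactor (allFin 2) (allFin (suc n)) f∈
    ... | r , j , _ , _ , refl =
      subst (_∈ hvPalFactors constantRows) (factorRows-rowPrefix r j)
            (∈-hvPalFactors constantRows (rowPrefix∈allPos r j) (rowPrefix-hvPal r j))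

theorem5p1 : (n : ℕ) → 1 ≤ n →
    ((k : ℕ) (w : Word2D (Fin k) 2 n) → numHVPal w ≤ 2 * n)
    × (Σ ℕ λ k → Σ (Word2D (Fin k) 2 n) λ w → numHVPal w ≡ 2 * n)
theorem5p1 (suc n) _ = (λ _ → numHVPal-2×n) , (2 , constantRows , numHVPal-constantRows)
  where open ConstantRows {n}
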